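{- Let $f:\mathbb N\to\mathbb N_0$ be defined by $f(n):=\left|\left\{(j,k)\in\mathbb N^2:\frac{jk(j+k)(j+2k)}{6}=n\right\}\right|$ and let $\Lambda:=\{n\in\mathbb N:f(n)\ne0\}$. Then for every prime $p$, the set $\Lambda\setminus(\Lambda\cap p\mathbb N)$ is infinite. -}

module Defs where

open import Data.Nat using (ℕ; _*_; _+_; _≥_; NonZero)
open import Data.Nat.Divisibility using (_∣_)
open import Data.Product using (∃; ∃-syntax; _×_)
open import Relation.Nullary using (¬_)
open import Relation.Binary.PropositionalEquality using (_≡_)

Q : ℕ → ℕ → ℕ
Q j k = j * k * (j + k) * (j + 2 * k)

Rep : ℕ → ℕ → ℕ → Set
Rep n j k = NonZero j × NonZero k × Q j k ≡ 6 * n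

Λ : ℕ → Set
Λ n = NonZero n × ∃[ j ] ∃[ k ] Rep n j k

Infinite : (ℕ → Set) → Set
Infinite P = ∀ m → ∃[ n ] (n ≥ m × P n)

ΛNotMult : ℕ → ℕ → Set
ΛNotMult p n = Λ n × ¬ (p ∣ n)

-- For every a, Q (1 + 6a) 1 = (1 + 6a)(2 + 6a)(3 + 6a) = 6 (1 + 6a)(1 + 3a)(1 + 2a),
-- so n = (1 + 6a)(1 + 3a)(1 + 2a) lies in Λ, and n ≡ 1 (mod a). Taking a = p t gives
-- elements of Λ that are ≡ 1 (mod p) and at least t, for every t.
module Submission where

open import Defs
open import Data.Nat using (ℕ; suc; _+_; _*_; _≤_)
open import Data.Nat.Properties using (+-comm; m≤m*n; m≤n*m; n≤1+n; ≤-trans)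
open import Data.Nat.Divisibility using (_∣_; ∣m+n∣m⇒∣n; ∣1⇒≡1; m∣m*n; ∣-trans)
open import Data.Nat.Primality using (Prime; prime⇒nonZero; ¬prime[1])
open import Data.Nat.Solver using (module +-*-Solver)
open import Data.Product using (_,_)
open import Relation.Nullary using (¬_)
open import Relation.Binary.PropositionalEquality using (_≡_; refl; subst)
open +-*-Solver

-- (1 + 6a)(1 + 3a)(1 + 2a), expanded so that its residue 1 mod a is visible.
N : ℕ → ℕ
N a = suc (a * (11 + 36 * a * suc a))

Q[1+6a,1]≡6*N[a] : ∀ a → Q (suc (6 * a)) 1 ≡ 6 * N a
Q[1+6a,1]≡6*N[a] = solve 1 (λ a →
    (con 1 :+ con 6 :* a) :* con 1 :* ((con 1 :+ con 6 :* a) :+ con 1)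
      :* ((con 1 :+ con 6 :* a) :+ con 2 :* con 1)
  := con 6 :* (con 1 :+ a :* (con 11 :+ con 36 :* a :* (con 1 :+ a))))
  refl

Λ-N : ∀ a → Λ (N a)
Λ-N a = _ , suc (6 * a) , 1 , _ , _ , Q[1+6a,1]≡6*N[a] a

n≤N[n] : ∀ n → n ≤ N n
n≤N[n] n = ≤-trans (m≤m*n n (11 + 36 * n * suc n)) (n≤1+n _)

∣n∣1+n⇒≡1 : ∀ {d n} → d ∣ n → d ∣ suc n → d ≡ 1
∣n∣1+n⇒≡1 {d} {n} d∣n d∣1+n =
  ∣1⇒≡1 (∣m+n∣m⇒∣n (subst (d ∣_) (+-comm 1 n) d∣1+n) d∣n)

lemma5p5 : ∀ (p : ℕ) → Prime p → Infinite (ΛNotMult p)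
lemma5p5 p p-prime t = N (p * t) , t≤N[pt] , Λ-N (p * t) , p∤N[pt]
  where
  instance _ = prime⇒nonZero p-prime
  t≤N[pt] : t ≤ N (p * t)
  t≤N[pt] = ≤-trans (m≤n*m t p) (n≤N[n] (p * t))
  p∤N[pt] : ¬ p ∣ N (p * t)
  p∤N[pt] p∣N = ¬prime[1] (subst Prime (∣n∣1+n⇒≡1 (∣-trans (m∣m*n t) (m∣m*n _)) p∣N) p-prime)
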